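{- Let $q\geq 3$ be odd, let $k\geq 2$ and let $n\geq k$ be integers. For $j=1,\ldots,k$, let $m_j$ be the number of strings in the list $\mathcal F_{n-j}^{(k)}$, let $\alpha_i^{(j)}$ ($1\le i\le m_j$) be the $i$-th element of the list $0^{j-1}1\cdot\overline{\mathcal F_{n-j}^{(k)}}$, and let $$\Gamma_j=\varepsilon(\alpha_1^{(j)})\circ\overline{\varepsilon(\alpha_2^{(j)})}\circ\varepsilon(\alpha_3^{(j)})\circ\overline{\varepsilon(\alpha_4^{(j)})}\circ\cdots\circ\varepsilon'(\alpha_{m_j}^{(j)}),$$ where the expansions are alternately taken in direct and reversed order (direct for odd $i$, reversed for even $i$), so that $\varepsilon'(\alpha_{m_j}^{(j)})=\varepsilon(\alpha_{m_j}^{(j)})$ if $m_j$ is odd and $\varepsilon'(\alpha_{m_j}^{(j)})=\overline{\varepsilon(\alpha_{m_j}^{(j)})}$ if $m_j$ is even. Then the list $\mathcal F_{n,q}^{(k)}=\Gamma_1\circ\Gamma_2\circ\cdots\circ\Gamma_k$ is a Gray code list with Hamming distance 1: any two consecutive strings in it differ in exactly one position.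
   Context: Lists are finite ordered sequences of strings. For a list $\mathcal L$, $\overline{\mathcal L}$ is $\mathcal L$ in reverse order; for a string $u$, $u\cdot\mathcal L$ is the list obtained by prepending $u$ to every string of $\mathcal L$; $\mathcal L\circ\mathcal L'$ is concatenation of lists; $\lambda$ is the empty string and $0^j$ is the string of $j$ zeros. Binary lists: $\mathcal C_0=(\lambda)$ and $\mathcal C_n=1\cdot\overline{\mathcal C_{n-1}}\circ 0\cdot\mathcal C_{n-1}$ for $n\ge1$; for fixed $k\ge2$, $\mathcal F_n^{(k)}=\mathcal C_n$ if $0\le n<k$, and $\mathcal F_n^{(k)}=1\cdot\overline{\mathcal F_{n-1}^{(k)}}\circ 01\cdot\overline{\mathcal F_{n-2}^{(k)}}\circ 001\cdot\overline{\mathcal F_{n-3}^{(k)}}\circ\cdots\circ 0^{k-1}1\cdot\overline{\mathcal F_{n-k}^{(k)}}$ if $n\ge k$ (this is a list of the binary strings of length $n$ avoiding $k$ consecutive 0's). For an ordered alphabet $(a_0,\ldots,a_{r-1})$, the reflected Gray code is $\mathcal G_0^r=(\lambda)$ and, for $n>0$, $\mathcal G_n^r=a_0\cdot\mathcal G_{n-1}^r\circ a_1\cdot\overline{\mathcal G_{n-1}^r}\circ a_2\cdot\mathcal G_{n-1}^r\circ\cdots$, where the block with prefix $a_i$ uses $\mathcal G_{n-1}^r$ for even $i$ and $\overline{\mathcal G_{n-1}^r}$ for odd $i$. Let $\mathcal G_t^{q-1}\oplus1$ denote $\mathcal G_t^{q-1}$ over the ordered alphabet $(1,2,\ldots,q-1)$.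 For a binary string $\beta$ with exactly $t$ ones, the expansion $\varepsilon(\beta)$ is the list of $(q-1)^t$ strings whose $i$-th element is obtained from $\beta$ by replacing its $t$ ones, from left to right, by the symbols of the $i$-th string of $\mathcal G_t^{q-1}\oplus1$. The resulting list $\mathcal F_{n,q}^{(k)}$ lists the strings of length $n$ over $\{0,1,\ldots,q-1\}$ avoiding $k$ consecutive 0's. -}

module Defs where

open import Data.Nat using (ℕ; zero; suc; _+_; _∸_; _<ᵇ_; _≡ᵇ_)
open import Data.Bool using (Bool; true; false; if_then_else_)
open import Data.List using (List; []; _∷_; _++_; map; reverse; concat; concatMap; replicate; length; upTo; lookup)
open import Data.Product using (_×_; _,_)
open import Relation.Binary.PropositionalEquality using (_≡_)

Str : Set
Str = List ℕ

Lst : Set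
Lst = List Str

_·_ : Str → Lst → Lst
u · L = map (u ++_) L

rev : Lst → Lst
rev = reverse

zeros : ℕ → Str
zeros j = replicate j 0

C : ℕ → Lst
C zero = [] ∷ []
C (suc n) = ((1 ∷ []) · rev (C n)) ++ ((0 ∷ []) · C n)

nth : {A : Set} → A → List A → ℕ → A
nth d [] _ = d
nth d (x ∷ xs) zero = x
nth d (x ∷ xs) (suc i) = nth d xs i

-- Ftab k n = ( F_n^{(k)} , F_{n-1}^{(k)} , ... , F_0^{(k)} )
-- computed by structural recursion on n following the definition:
-- F_n = C_n if n < k, otherwise
-- F_n = 1·rev F_{n-1} ∘ 01·rev F_{n-2} ∘ ... ∘ 0^{k-1}1·rev F_{n-k}.
Ftab : ℕ → ℕ → List Lst
Ftab k zero = C zero ∷ []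
Ftab k (suc n) = new ∷ prev
  where
  prev : List Lst
  prev = Ftab k n
  -- prev at index (j-1) is F_{(n+1)-j}
  new : Lst
  new = if suc n <ᵇ k
        then C (suc n)
        else concat (map (λ j → (zeros j ++ (1 ∷ [])) · rev (nth [] prev j)) (upTo k))

F : ℕ → ℕ → Lst
F k n = nth [] (Ftab k n) 0

G : ℕ → ℕ → Lst
G r zero = [] ∷ []
G r (suc n) = concat (map blk (upTo r))
  where
  blk : ℕ → Lst
  blk i = (i ∷ []) · (if Data.Nat._%_ i 2 ≡ᵇ 0 then G r n else rev (G r n))
    where open import Data.Nat using (_%_)

G⊕1 : ℕ → ℕ → Lst
G⊕1 r t = map (map suc) (G r t)

ones : Str → ℕ
ones [] = 0
ones (x ∷ xs) = (if x ≡ᵇ 1 then 1 else 0) + ones xs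

subst1 : Str → Str → Str
subst1 [] s = []
subst1 (x ∷ xs) s with x ≡ᵇ 1 | s
... | true  | (a ∷ s') = a ∷ subst1 xs s'
... | true  | []       = x ∷ subst1 xs []
... | false | s'       = x ∷ subst1 xs s'

ε : ℕ → Str → Lst
ε q β = map (subst1 β) (G⊕1 (q ∸ 1) (ones β))

altExp : ℕ → Bool → Lst → Lst
altExp q b [] = []
altExp q true  (a ∷ as) = ε q a ++ altExp q false as
altExp q false (a ∷ as) = rev (ε q a) ++ altExp q true as

Γ : ℕ → ℕ → ℕ → ℕ → Lst
Γ q k n j = altExp q true ((zeros (j ∸ 1) ++ (1 ∷ [])) · rev (F k (n ∸ j)))

Fq : ℕ → ℕ → ℕ → Lst
Fq q k n = concat (map (λ i → Γ q k n (suc i)) (upTo k))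

-- number of positions where two strings differ (on the common prefix)
diffs : Str → Str → ℕ
diffs [] _ = 0
diffs (_ ∷ _) [] = 0
diffs (x ∷ xs) (y ∷ ys) = (if x ≡ᵇ y then 0 else 1) + diffs xs ys

HammingOne : Str → Str → Set
HammingOne u v = (length u ≡ length v) × (diffs u v ≡ 1)

data GrayOne : Lst → Set where
  nil  : GrayOne []
  one  : ∀ u → GrayOne (u ∷ [])
  cons : ∀ u v L → HammingOne u v → GrayOne (v ∷ L) → GrayOne (u ∷ v ∷ L)

module Submission where

-- Call a nonempty list whose consecutive strings are at Hamming distance 1 a Gray path from its
-- first to its last string.  Gray paths survive reversal, prefixing, Hamming-preserving maps, and
-- concatenation when the end of one path is adjacent to the start of the next.  The reflected code
-- over the even alphabet (1, …, q−1) starts at 1^t and ends at (q−1)1^(t−1), so ε(0^j 1 u) is a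
-- Gray path from 0^j 1 u to 0^j (q−1) u; alternating directions, Γ_(j+1) is a Gray path from
-- 0^j 1·last F_(n−j−1) to 0^j d·first F_(n−j−1) with d ∈ {1, q−1}.  Since first F_(m+1) = 1·last F_m,
-- this end differs only in position j from the start 0^(j+1) 1·last F_(n−j−2) of Γ_(j+2).  The same
-- staircase argument, by strong induction on n, shows that F_n^(k) is a Gray path.

open import Defs
open import Data.Bool using (Bool; true; false; not; if_then_else_; T)
open import Data.List using ([]; _∷_; _++_; map; reverse; concat; replicate; length; upTo)
open import Data.List.Properties using (map-applyUpTo; unfold-reverse; ++-identityʳ; ++-assoc; length-map; map-replicate; length-replicate)
open import Data.Nat using (ℕ; zero; suc; pred; _+_; _∸_; _≤_; _<_; _%_; _≡ᵇ_; _<ᵇ_; _<?_; z≤n; s≤s)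
open import Data.Nat.Properties using (≡ᵇ⇒≡; <ᵇ⇒<; <⇒<ᵇ; <⇒≱; ≮⇒≥; 1+n≢n; m∸n≤m; +-∸-assoc; ≤-trans; n≤1+n; ≤-pred)
open import Data.Nat.Induction using (<-rec)
open import Data.Product using (Σ-syntax; _,_; proj₁; proj₂)
open import Data.Empty using (⊥-elim)
open import Relation.Nullary using (yes; no)
open import Function using (_∘_; id)
open import Relation.Binary.PropositionalEquality using (_≡_; _≢_; refl; sym; trans; cong; cong₂; subst; ≢-sym)

≡ᵇ-refl : ∀ x → (x ≡ᵇ x) ≡ true
≡ᵇ-refl zero = refl
≡ᵇ-refl (suc x) = ≡ᵇ-refl x

≡ᵇ-sym : ∀ x y → (x ≡ᵇ y) ≡ (y ≡ᵇ x)
≡ᵇ-sym zero zero = refl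
≡ᵇ-sym zero (suc y) = refl
≡ᵇ-sym (suc x) zero = refl
≡ᵇ-sym (suc x) (suc y) = ≡ᵇ-sym x y

≢⇒≡ᵇ-false : ∀ {x y} → x ≢ y → (x ≡ᵇ y) ≡ false
≢⇒≡ᵇ-false {x} {y} x≢y with x ≡ᵇ y in eq
... | true = ⊥-elim (x≢y (≡ᵇ⇒≡ x y (subst T (sym eq) _)))
... | false = refl

%2-suc : ∀ i → (suc i % 2 ≡ᵇ 0) ≡ not (i % 2 ≡ᵇ 0)
%2-suc zero = refl
%2-suc (suc zero) = refl
%2-suc (suc (suc i)) = %2-suc i

∸≡suc∸suc : ∀ {m n} → suc n ≤ m → m ∸ n ≡ suc (m ∸ suc n)
∸≡suc∸suc = +-∸-assoc 1

diffs-refl : ∀ x → diffs x x ≡ 0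
diffs-refl [] = refl
diffs-refl (a ∷ x) rewrite ≡ᵇ-refl a = diffs-refl x

diffs-sym : ∀ x y → diffs x y ≡ diffs y x
diffs-sym [] [] = refl
diffs-sym [] (_ ∷ _) = refl
diffs-sym (_ ∷ _) [] = refl
diffs-sym (a ∷ x) (b ∷ y) rewrite ≡ᵇ-sym a b | diffs-sym x y = refl

diffs-map-suc : ∀ x y → diffs (map suc x) (map suc y) ≡ diffs x y
diffs-map-suc [] [] = refl
diffs-map-suc [] (_ ∷ _) = refl
diffs-map-suc (_ ∷ _) [] = refl
diffs-map-suc (a ∷ x) (b ∷ y) = cong ((if a ≡ᵇ b then 0 else 1) +_) (diffs-map-suc x y)

HammingOne-sym : ∀ {x y} → HammingOne x y → HammingOne y x
HammingOne-sym {x} {y} (len , d) = sym len , trans (diffs-sym y x) d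

HammingOne-prefix : ∀ w {x y} → HammingOne x y → HammingOne (w ++ x) (w ++ y)
HammingOne-prefix [] h = h
HammingOne-prefix (a ∷ w) h with HammingOne-prefix w h
... | len , d rewrite ≡ᵇ-refl a = cong suc len , d

HammingOne-prefix-∷ : ∀ w a {x y} → HammingOne x y → HammingOne (w ++ a ∷ x) (w ++ a ∷ y)
HammingOne-prefix-∷ w a {x} {y} h = HammingOne-prefix w {a ∷ x} {a ∷ y} (HammingOne-prefix (a ∷ []) {x} {y} h)

HammingOne-head : ∀ a b x → a ≢ b → HammingOne (a ∷ x) (b ∷ x)
HammingOne-head a b x a≢b rewrite ≢⇒≡ᵇ-false a≢b | diffs-refl x = refl , refl

HammingOne-map-suc : ∀ {x y} → HammingOne x y → HammingOne (map suc x) (map suc y)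
HammingOne-map-suc {x} {y} (len , d) =
  trans (length-map suc x) (trans len (sym (length-map suc y))) , trans (diffs-map-suc x y) d

HammingOne-staircase : ∀ j {d} y → d ≢ 0 → HammingOne (zeros j ++ d ∷ y) (zeros (suc j) ++ y)
HammingOne-staircase zero {d} y d≢0 = HammingOne-head d 0 y d≢0
HammingOne-staircase (suc j) y d≢0 =
  HammingOne-prefix (0 ∷ []) {zeros j ++ _ ∷ y} {zeros (suc j) ++ y} (HammingOne-staircase j y d≢0)

data GrayPath : Str → Lst → Str → Set where
  single : ∀ u → GrayPath u (u ∷ []) u
  step   : ∀ {u v w L} → HammingOne u v → GrayPath v L w → GrayPath u (u ∷ L) w

GrayPath-cast : ∀ {u u' L L' v v'} → u ≡ u' → L ≡ L' → v ≡ v' → GrayPath u L v → GrayPath u' L' v'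
GrayPath-cast refl refl refl p = p

GrayPath⇒GrayOne : ∀ {u L w} → GrayPath u L w → GrayOne L
GrayPath⇒GrayOne (single u) = one u
GrayPath⇒GrayOne (step h (single v)) = cons _ v [] h (one v)
GrayPath⇒GrayOne (step h p@(step _ _)) = cons _ _ _ h (GrayPath⇒GrayOne p)

GrayPath-++ : ∀ {u v w x L M} → GrayPath u L v → HammingOne v w → GrayPath w M x → GrayPath u (L ++ M) x
GrayPath-++ (single u) h q = step h q
GrayPath-++ (step h' p) h q = step h' (GrayPath-++ p h q)

GrayPath-reverse : ∀ {u L v} → GrayPath u L v → GrayPath v (reverse L) u
GrayPath-reverse (single u) = single u
GrayPath-reverse {u} (step {v = v} {L = L} h p) rewrite unfold-reverse u L =
  GrayPath-++ (GrayPath-reverse p) (HammingOne-sym {u} {v} h) (single u)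

GrayPath-map : ∀ (f : Str → Str) m → (∀ x y → length x ≡ m → HammingOne x y → HammingOne (f x) (f y)) →
               ∀ {u L v} → length u ≡ m → GrayPath u L v → GrayPath (f u) (map f L) (f v)
GrayPath-map f m f-hamming len (single u) = single (f u)
GrayPath-map f m f-hamming len (step h p) =
  step (f-hamming _ _ len h) (GrayPath-map f m f-hamming (trans (sym (proj₁ h)) len) p)

GrayPath-prefix : ∀ w {u L v} → GrayPath u L v → GrayPath (w ++ u) (w · L) (w ++ v)
GrayPath-prefix w {u} = GrayPath-map (w ++_) (length u) (λ x y _ → HammingOne-prefix w {x} {y}) refl

concat-map-upTo-suc : ∀ (f : ℕ → Lst) i →
                      concat (map f (upTo (suc i))) ≡ f 0 ++ concat (map (f ∘ suc) (upTo i))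
concat-map-upTo-suc f i =
  cong (λ L → f 0 ++ concat L) (trans (map-applyUpTo suc f i) (sym (map-applyUpTo id (f ∘ suc) i)))

GrayPath-concat : ∀ (f : ℕ → Lst) (a b : ℕ → Str) i →
                  (∀ j → j ≤ i → GrayPath (a j) (f j) (b j)) →
                  (∀ j → j < i → HammingOne (b j) (a (suc j))) →
                  GrayPath (a 0) (concat (map f (upTo (suc i)))) (b i)
GrayPath-concat f a b zero path link = GrayPath-cast refl (sym (++-identityʳ (f 0))) refl (path 0 z≤n)
GrayPath-concat f a b (suc i) path link =
  GrayPath-cast refl (sym (concat-map-upTo-suc f (suc i))) refl
    (GrayPath-++ (path 0 z≤n) (link 0 (s≤s z≤n))
      (GrayPath-concat (f ∘ suc) (a ∘ suc) (b ∘ suc) i (λ j → path (suc j) ∘ s≤s) (λ j → link (suc j) ∘ s≤s)))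

-- Junk value [] on the empty list; only applied to Gray paths.
first : Lst → Str
first [] = []
first (u ∷ _) = u

final : Lst → Str
final [] = []
final (u ∷ []) = u
final (_ ∷ v ∷ L) = final (v ∷ L)

GrayPath-first : ∀ {u L v} → GrayPath u L v → first L ≡ u
GrayPath-first (single u) = refl
GrayPath-first (step h p) = refl

GrayPath-final : ∀ {u L v} → GrayPath u L v → final L ≡ v
GrayPath-final (single u) = refl
GrayPath-final (step h (single v)) = refl
GrayPath-final (step h p@(step _ _)) = GrayPath-final p

GrayPath-endpoints : ∀ {u L v} → GrayPath u L v → GrayPath (first L) L (final L)
GrayPath-endpoints p = GrayPath-cast (sym (GrayPath-first p)) refl (sym (GrayPath-final p)) p

first-++ : ∀ {u L v} M → GrayPath u L v → first (L ++ M) ≡ u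
first-++ M (single u) = refl
first-++ M (step h p) = refl

first-reflect : ∀ M {u L v} → GrayPath u L v → first ((1 ∷ []) · reverse L ++ M) ≡ 1 ∷ v
first-reflect M p = first-++ M (GrayPath-prefix (1 ∷ []) (GrayPath-reverse p))

C-isGrayPath : ∀ m → Σ[ u ∈ Str ] GrayPath u (C m) (zeros m)
C-isGrayPath zero = [] , single []
C-isGrayPath (suc m) with C-isGrayPath m
... | u , p = 1 ∷ zeros m ,
  GrayPath-++ (GrayPath-prefix (1 ∷ []) (GrayPath-reverse p)) (HammingOne-head 1 0 u (λ ()))
              (GrayPath-prefix (0 ∷ []) p)

G-suc-isGrayPath : ∀ r t {e} → GrayPath (zeros t) (G (suc r) t) e →
                   GrayPath (zeros (suc t)) (G (suc r) (suc t)) (r ∷ (if r % 2 ≡ᵇ 0 then e else zeros t))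
G-suc-isGrayPath r t {e} p = GrayPath-concat block start end r block-isGrayPath link
  where
  block : ℕ → Lst
  block i = (i ∷ []) · (if i % 2 ≡ᵇ 0 then G (suc r) t else rev (G (suc r) t))

  start end : ℕ → Str
  start i = i ∷ (if i % 2 ≡ᵇ 0 then zeros t else e)
  end i = i ∷ (if i % 2 ≡ᵇ 0 then e else zeros t)

  block-isGrayPath : ∀ i → i ≤ r → GrayPath (start i) (block i) (end i)
  block-isGrayPath i _ with i % 2 ≡ᵇ 0
  ... | true = GrayPath-prefix (i ∷ []) p
  ... | false = GrayPath-prefix (i ∷ []) (GrayPath-reverse p)

  link : ∀ i → i < r → HammingOne (end i) (start (suc i))
  link i _ rewrite %2-suc i with i % 2 ≡ᵇ 0
  ... | true = HammingOne-head i (suc i) e (≢-sym 1+n≢n)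
  ... | false = HammingOne-head i (suc i) (zeros t) (≢-sym 1+n≢n)

G-isGrayPath : ∀ r t → Σ[ e ∈ Str ] GrayPath (zeros t) (G (suc r) t) e
G-isGrayPath r zero = [] , single []
G-isGrayPath r (suc t) = _ , G-suc-isGrayPath r t (proj₂ (G-isGrayPath r t))

G-final : ∀ r t → r % 2 ≡ 1 → GrayPath (zeros (suc t)) (G (suc r) (suc t)) (r ∷ zeros t)
G-final r t r-odd with G-isGrayPath r t
... | e , p = GrayPath-cast refl refl (cong (λ b → r ∷ (if b then e else zeros t)) (cong (_≡ᵇ 0) r-odd))
                (G-suc-isGrayPath r t p)

length-subst1 : ∀ β s → length (subst1 β s) ≡ length β
length-subst1 [] s = refl
length-subst1 (x ∷ β) s with x ≡ᵇ 1 | s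
... | true | a ∷ s' = cong suc (length-subst1 β s')
... | true | [] = cong suc (length-subst1 β [])
... | false | s' = cong suc (length-subst1 β s')

diffs-subst1 : ∀ β s s' → length s ≡ ones β → length s' ≡ ones β → diffs (subst1 β s) (subst1 β s') ≡ diffs s s'
diffs-subst1 [] [] [] _ _ = refl
diffs-subst1 [] [] (_ ∷ _) _ ()
diffs-subst1 [] (_ ∷ _) _ () _
diffs-subst1 (x ∷ β) s s' len len' with x ≡ᵇ 1
diffs-subst1 (x ∷ β) (a ∷ s) (b ∷ s') len len' | true =
  cong ((if a ≡ᵇ b then 0 else 1) +_) (diffs-subst1 β s s' (cong pred len) (cong pred len'))
diffs-subst1 (x ∷ β) [] _ () _ | true
diffs-subst1 (x ∷ β) (_ ∷ _) [] _ () | true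
diffs-subst1 (x ∷ β) s s' len len' | false rewrite ≡ᵇ-refl x = diffs-subst1 β s s' len len'

HammingOne-subst1 : ∀ β s s' → length s ≡ ones β → HammingOne s s' → HammingOne (subst1 β s) (subst1 β s')
HammingOne-subst1 β s s' len (len≡ , d) =
  trans (length-subst1 β s) (sym (length-subst1 β s')) , trans (diffs-subst1 β s s' len (trans (sym len≡) len)) d

subst1-ones : ∀ β → subst1 β (replicate (ones β) 1) ≡ β
subst1-ones [] = refl
subst1-ones (x ∷ β) with x ≡ᵇ 1 in eq
... | true = cong₂ _∷_ (sym (≡ᵇ⇒≡ x 1 (subst T (sym eq) _))) (subst1-ones β)
... | false = cong (x ∷_) (subst1-ones β)

ones-staircase : ∀ j u → ones ((zeros j ++ 1 ∷ []) ++ u) ≡ suc (ones u)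
ones-staircase zero u = refl
ones-staircase (suc j) u = ones-staircase j u

subst1-staircase : ∀ j u c s → subst1 ((zeros j ++ 1 ∷ []) ++ u) (c ∷ s) ≡ zeros j ++ c ∷ subst1 u s
subst1-staircase zero u c s = refl
subst1-staircase (suc j) u c s = cong (0 ∷_) (subst1-staircase j u c s)

-- The symbol replacing the leading 1 of 0^j 1 u at either end of ε(0^j 1 u), for q = r + 2.
digit : ℕ → Bool → ℕ
digit r true = 1
digit r false = suc r

digit≢0 : ∀ r c → digit r c ≢ 0
digit≢0 r true ()
digit≢0 r false ()

module _ (r : ℕ) (r-odd : r % 2 ≡ 1) where

  G⊕1-final : ∀ t → GrayPath (replicate (suc t) 1) (G⊕1 (suc r) (suc t)) (suc r ∷ replicate t 1)
  G⊕1-final t = GrayPath-cast (map-replicate suc (suc t) 0) refl (cong (suc r ∷_) (map-replicate suc t 0))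
    (GrayPath-map (map suc) (suc t) (λ x y _ → HammingOne-map-suc {x} {y}) (length-replicate (suc t))
      (G-final r t r-odd))

  ε-isGrayPath : ∀ β t → ones β ≡ suc t → GrayPath β (ε (suc (suc r)) β) (subst1 β (suc r ∷ replicate t 1))
  ε-isGrayPath β t ones≡ =
    GrayPath-cast start≡ (cong (λ n → map (subst1 β) (G⊕1 (suc r) n)) (sym ones≡)) refl
      (GrayPath-map (subst1 β) (suc t) (λ x y len → HammingOne-subst1 β x y (trans len (sym ones≡)))
        (length-replicate (suc t)) (G⊕1-final t))
    where
    start≡ : subst1 β (replicate (suc t) 1) ≡ β
    start≡ = trans (cong (λ n → subst1 β (replicate n 1)) (sym ones≡)) (subst1-ones β)

  ε-staircase-isGrayPath : ∀ j u → GrayPath (zeros j ++ 1 ∷ u) (ε (suc (suc r)) ((zeros j ++ 1 ∷ []) ++ u))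
                                            (zeros j ++ suc r ∷ u)
  ε-staircase-isGrayPath j u =
    GrayPath-cast (++-assoc (zeros j) (1 ∷ []) u) refl
      (trans (subst1-staircase j u (suc r) _) (cong (λ s → zeros j ++ suc r ∷ s) (subst1-ones u)))
      (ε-isGrayPath ((zeros j ++ 1 ∷ []) ++ u) (ones u) (ones-staircase j u))

  altExp-isGrayPath : ∀ j b {u M v} → GrayPath u M v →
    Σ[ c ∈ Bool ] GrayPath (zeros j ++ digit r b ∷ u) (altExp (suc (suc r)) b ((zeros j ++ 1 ∷ []) · M))
                           (zeros j ++ digit r c ∷ v)
  altExp-isGrayPath j true (single u) =
    false , GrayPath-cast refl (sym (++-identityʳ _)) refl (ε-staircase-isGrayPath j u)
  altExp-isGrayPath j false (single u) =
    true , GrayPath-cast refl (sym (++-identityʳ _)) refl (GrayPath-reverse (ε-staircase-isGrayPath j u))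
  altExp-isGrayPath j true (step h p) with altExp-isGrayPath j false p
  ... | c , q = c , GrayPath-++ (ε-staircase-isGrayPath j _) (HammingOne-prefix-∷ (zeros j) (suc r) h) q
  altExp-isGrayPath j false (step h p) with altExp-isGrayPath j true p
  ... | c , q = c , GrayPath-++ (GrayPath-reverse (ε-staircase-isGrayPath j _)) (HammingOne-prefix-∷ (zeros j) 1 h) q

module _ (k' : ℕ) where
  private
    k : ℕ
    k = suc k'

  F-block : ℕ → ℕ → Lst
  F-block n j = (zeros j ++ 1 ∷ []) · rev (nth [] (Ftab k n) j)

  F-<k : ∀ n → n < k → F k n ≡ C n
  F-<k zero _ = refl
  F-<k (suc n) n<k with suc n <ᵇ k in eq
  ... | true = refl
  ... | false = ⊥-elim (subst T eq (<⇒<ᵇ n<k))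

  F-≥k : ∀ n → k ≤ suc n → F k (suc n) ≡ concat (map (F-block n) (upTo k))
  F-≥k n k≤n with suc n <ᵇ k in eq
  ... | true = ⊥-elim (<⇒≱ (<ᵇ⇒< (suc n) k (subst T (sym eq) _)) k≤n)
  ... | false = refl

  nth-Ftab : ∀ n j → j ≤ n → nth [] (Ftab k n) j ≡ F k (n ∸ j)
  nth-Ftab n zero _ = refl
  nth-Ftab (suc n) (suc j) (s≤s j≤n) = nth-Ftab n j j≤n

  first-F-suc : ∀ n {u v} → GrayPath u (F k n) v → first (F k (suc n)) ≡ 1 ∷ v
  first-F-suc n p with suc n <? k
  ... | yes n+1<k = trans (cong first (F-<k (suc n) n+1<k))
                          (first-reflect _ (GrayPath-cast refl (F-<k n (≤-trans (n≤1+n _) n+1<k)) refl p))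
  ... | no n+1≮k = trans (cong first (F-≥k n (≮⇒≥ n+1≮k))) (first-reflect _ p)

  staircase-link : ∀ n j {d u v} → d ≢ 0 → suc j ≤ n → GrayPath u (F k (n ∸ suc j)) v →
                   HammingOne (zeros j ++ d ∷ first (F k (n ∸ j))) (zeros (suc j) ++ 1 ∷ v)
  staircase-link n j {v = v} d≢0 j<n p rewrite ∸≡suc∸suc j<n | first-F-suc (n ∸ suc j) p =
    HammingOne-staircase j (1 ∷ v) d≢0

  F-isGrayPath : ∀ n → GrayPath (first (F k n)) (F k n) (final (F k n))
  F-isGrayPath = <-rec _ F-step
    where
    F-step : ∀ n → (∀ {m} → m < n → GrayPath (first (F k m)) (F k m) (final (F k m))) →
             GrayPath (first (F k n)) (F k n) (final (F k n))
    F-step zero _ = single []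
    F-step (suc n) IH with suc n <? k
    ... | yes n+1<k = GrayPath-endpoints
                        (GrayPath-cast refl (sym (F-<k (suc n) n+1<k)) refl (proj₂ (C-isGrayPath (suc n))))
    ... | no n+1≮k = GrayPath-endpoints (GrayPath-cast refl (sym (F-≥k n (≮⇒≥ n+1≮k))) refl
                       (GrayPath-concat (F-block n) start end k' block link))
      where
      k'≤n : k' ≤ n
      k'≤n = ≤-pred (≮⇒≥ n+1≮k)

      path : ∀ j → GrayPath (first (F k (n ∸ j))) (F k (n ∸ j)) (final (F k (n ∸ j)))
      path j = IH (s≤s (m∸n≤m n j))

      start end : ℕ → Str
      start j = zeros j ++ 1 ∷ final (F k (n ∸ j))
      end j = zeros j ++ 1 ∷ first (F k (n ∸ j))

      block : ∀ j → j ≤ k' → GrayPath (start j) (F-block n j) (end j)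
      block j j≤k' rewrite nth-Ftab n j (≤-trans j≤k' k'≤n) =
        GrayPath-cast (++-assoc (zeros j) (1 ∷ []) _) refl (++-assoc (zeros j) (1 ∷ []) _)
          (GrayPath-prefix (zeros j ++ 1 ∷ []) (GrayPath-reverse (path j)))

      link : ∀ j → j < k' → HammingOne (end j) (start (suc j))
      link j j<k' = staircase-link n j (λ ()) (≤-trans j<k' k'≤n) (path (suc j))

-- q % 2 reduces to r % 2, and only k ≥ 1 is used.
proposition3 : (q k n : ℕ) → 3 ≤ q → q % 2 ≡ 1 → 2 ≤ k → k ≤ n → GrayOne (Fq q k n)
proposition3 (suc (suc r)) (suc k') (suc n) (s≤s (s≤s _)) r-odd (s≤s _) (s≤s k'≤n) =
  GrayPath⇒GrayOne
    (GrayPath-concat (λ j → Γ q k (suc n) (suc j)) start end k' (λ j _ → proj₂ (Γ-path j)) link)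
  where
  q k : ℕ
  q = suc (suc r)
  k = suc k'

  Γ-path : ∀ j → Σ[ c ∈ Bool ] GrayPath (zeros j ++ 1 ∷ final (F k (n ∸ j))) (Γ q k (suc n) (suc j))
                                        (zeros j ++ digit r c ∷ first (F k (n ∸ j)))
  Γ-path j = altExp-isGrayPath r r-odd j true (GrayPath-reverse (F-isGrayPath k' (n ∸ j)))

  start end : ℕ → Str
  start j = zeros j ++ 1 ∷ final (F k (n ∸ j))
  end j = zeros j ++ digit r (proj₁ (Γ-path j)) ∷ first (F k (n ∸ j))

  link : ∀ j → j < k' → HammingOne (end j) (start (suc j))
  link j j<k' = staircase-link k' n j (digit≢0 r _) (≤-trans j<k' k'≤n) (F-isGrayPath k' (n ∸ suc j))
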